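{- Let $G$ be a connected graph of girth $4$ and let $(x,y)\in E(G)$ with $d_x=d_y=d$. Then $\kappa(x,y)=0$ if and only if there is a perfect matching between $N_G(x)$ and $N_G(y)$, i.e. a bijection $\sigma:N_G(x)\to N_G(y)$ with $(z,\sigma(z))\in E(G)$ for all $z\in N_G(x)$.
   Context: Graphs are locally finite, simple, unweighted. $N_G(v)$ is the neighbor set of $v$, $d_v$ its degree, $d_G$ the shortest-path metric. For a vertex $v$, $m_v$ is the uniform probability measure on $N_G(v)$; $W_1(\mu_1,\mu_2)=\inf_\nu\sum_{a,b}d_G(a,b)\nu(a,b)$ over couplings $\nu$ of $\mu_1,\mu_2$; for an edge $(x,y)$, $\kappa(x,y)=1-W_1(m_x,m_y)$ (Ollivier's coarse Ricci curvature).
   Formalization: The couplings ν of $m_x$ and $m_y$ in the infimum defining $W_1$, and hence in κ(x,y)=0, take only rational values. -}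

module Defs where

open import Level using (Level; _⊔_) renaming (suc to lsuc)
open import Data.Nat as ℕ using (ℕ; zero; suc)
open import Data.Fin using (Fin; zero; suc; inject₁; fromℕ)
open import Data.List using (List; length; lookup)
open import Data.List.Membership.Propositional using (_∈_)
open import Data.List.Relation.Unary.Unique.Propositional using (Unique)
open import Data.Product using (Σ; _×_; ∃; ∃-syntax)
open import Data.Integer using (+_)
open import Data.Rational as ℚ using (ℚ; 0ℚ; 1ℚ; _/_; _+_; _*_; _-_; _≤_; _<_)
open import Data.Empty using (⊥)
open import Relation.Binary.PropositionalEquality using (_≡_)
open import Relation.Nullary using (¬_)
open import Function.Definitions using (Injective)
open import Function.Bundles using (_⇔_; _⤖_; Bijection)

record Graph : Set₁ where
  field
    V      : Set
    _~_    : V → V → Set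
    ~-sym  : ∀ {a b} → a ~ b → b ~ a
    ~-irr  : ∀ {a} → ¬ (a ~ a)
    nbrs   : V → List V
    nbrs-unique : ∀ v → Unique (nbrs v)
    nbrs-spec   : ∀ v w → (w ∈ nbrs v) ⇔ (v ~ w)

  deg : V → ℕ
  deg v = length (nbrs v)

  nb : (v : V) → Fin (deg v) → V
  nb v = lookup (nbrs v)

  data Walk : V → V → ℕ → Set where
    here : ∀ {a} → Walk a a 0
    step : ∀ {a b c n} → a ~ b → Walk b c n → Walk a c (suc n)

  Connected : Set
  Connected = ∀ a b → ∃[ n ] Walk a b n

  IsGraphMetric : (V → V → ℕ) → Set
  IsGraphMetric dist = ∀ a b → Walk a b (dist a b) × (∀ n → Walk a b n → dist a b ℕ.≤ n)

  -- a cycle of length (suc m): injective f : Fin (suc m) → V with consecutive vertices adjacent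
  HasCycle : ℕ → Set
  HasCycle m = Σ (Fin (suc m) → V) λ f →
    Injective _≡_ _≡_ f × (∀ (i : Fin m) → f (inject₁ i) ~ f (suc i)) × (f (fromℕ m) ~ f zero)

  -- girth 4: there is a cycle of length 4, and no cycle of length 3
  -- (cycles in a simple graph have length ≥ 3)
  Girth4 : Set
  Girth4 = HasCycle 3 × ¬ HasCycle 2

sumFin : ∀ n → (Fin n → ℚ) → ℚ
sumFin zero    f = 0ℚ
sumFin (suc n) f = f zero + sumFin n (λ i → f (suc i))

unif : ℕ → ℚ
unif zero    = 0ℚ
unif (suc n) = + 1 / suc n

nat : ℕ → ℚ
nat n = + n / 1

module _ (G : Graph) (dist : Graph.V G → Graph.V G → ℕ) where
  open Graph G

  -- couplings of m_x and m_y; a coupling of these measures is necessarily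
  -- supported on N(x) × N(y), so we index it by neighbour indices.
  IsCoupling : (x y : V) → (Fin (deg x) → Fin (deg y) → ℚ) → Set
  IsCoupling x y ν =
      (∀ i j → 0ℚ ≤ ν i j)
    × (∀ i → sumFin (deg y) (ν i) ≡ unif (deg x))
    × (∀ j → sumFin (deg x) (λ i → ν i j) ≡ unif (deg y))

  cost : (x y : V) → (Fin (deg x) → Fin (deg y) → ℚ) → ℚ
  cost x y ν = sumFin (deg x) λ i → sumFin (deg y) λ j →
    ν i j * nat (dist (nb x i) (nb y j))

  W1Is : (x y : V) → ℚ → Set
  W1Is x y w =
      (∀ ν → IsCoupling x y ν → w ≤ cost x y ν)
    × (∀ ε → 0ℚ < ε → ∃[ ν ] (IsCoupling x y ν × cost x y ν < w + ε))

  CurvatureIs : (x y : V) → ℚ → Set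
  CurvatureIs x y k = W1Is x y (1ℚ - k)

PerfectMatching : (G : Graph) → (x y : Graph.V G) → Set
PerfectMatching G x y = Σ (Fin (deg x) ⤖ Fin (deg y)) λ σ →
  ∀ i → nb x i ~ nb y (Bijection.to σ i)
  where open Graph G

-- Triangle-freeness puts every neighbour of x at distance at least 1 from every neighbour of y,
-- so every coupling of m_x and m_y costs at least 1, and a perfect matching of the adjacency
-- relation between N(x) and N(y) is a coupling of cost exactly 1: then κ(x,y) = 0. Without a
-- perfect matching, Hall's theorem gives A ⊆ N(x) whose neighbours in N(y) form a set B with
-- |B| < |A|. The potentials 1 + 1_A on N(x) and 1_B on N(y) are feasible for the dual transport
-- problem, so by weak Kantorovich duality every coupling costs at least 1 + 1/d and κ(x,y) < 0.
module Submission where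

open import Defs
open import Data.Rational as ℚ using (ℚ; 0ℚ; 1ℚ)
import Data.Rational.Properties as ℚ
open import Algebra.Bundles using (Semiring; CommutativeRing)
open import Data.Bool using (Bool; true; false; T; T?; not; _∨_; if_then_else_)
open import Data.Empty using (⊥-elim)
open import Data.Fin using (Fin; zero; suc; _≟_; punchOut)
open import Data.Fin.Properties using (any?; ¬Fin0; punchOut-injective; injective⇒≤)
open import Data.Nat as ℕ using (ℕ; zero; suc; z≤n; s≤s; s≤s⁻¹)
import Data.Nat.Properties as ℕ
open import Data.Product using (Σ; ∃; ∃₂; ∃-syntax; _×_; _,_; proj₁; proj₂; map₂)
open import Data.Sum using (_⊎_; inj₁; inj₂; [_,_]′)
open import Data.Unit using (tt)
open import Data.Vec.Functional using (Vector)
open import Function using (_∘_; const)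
open import Function.Bundles using (_⇔_; mk⇔; Equivalence; _⤖_; mk⤖; Bijection)
open import Function.Definitions using (Injective)
open import Relation.Binary.Definitions using (Decidable)
open import Relation.Binary.PropositionalEquality as ≡ using (_≡_; _≢_; refl; cong; cong₂; subst; subst₂)
open import Relation.Nullary using (¬_; Dec; yes; no; does; contradiction)
open import Relation.Nullary.Decidable using (⌊_⌋; dec-true; dec-false; toWitness; _×-dec_; ¬?)

module KroneckerSum {c ℓ} (S : Semiring c ℓ) where
  open Semiring S using (Carrier; _≈_; _+_; _*_; 0#; 1#; setoid; trans; +-cong; +-identityˡ; +-identityʳ; *-identityˡ; zeroˡ)
  open import Algebra.Properties.Semiring.Sum S
  open import Relation.Binary.Reasoning.Setoid setoid

  δ : ∀ {n} → Fin n → Fin n → Carrier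
  δ i j = if does (i ≟ j) then 1# else 0#

  δ-refl : ∀ {n} (i : Fin n) → δ i i ≡ 1#
  δ-refl i rewrite dec-true (i ≟ i) refl = refl

  δ-injective : ∀ {m n} {f : Fin m → Fin n} → Injective _≡_ _≡_ f → ∀ (i i′ : Fin m) → δ (f i) (f i′) ≡ δ i i′
  δ-injective {f = f} f-inj i i′ with i ≟ i′
  ... | yes refl = δ-refl (f i)
  ... | no i≢i′ rewrite dec-false (f i ≟ f i′) (i≢i′ ∘ f-inj) = refl

  δ-sym : ∀ {n} (i j : Fin n) → δ i j ≡ δ j i
  δ-sym i j with i ≟ j
  ... | yes refl = ≡.sym (δ-refl i)
  ... | no i≢j rewrite dec-false (j ≟ i) (i≢j ∘ ≡.sym) = refl

  ∑-δ : ∀ {n} (i : Fin n) (x : Vector Carrier n) → ∑[ j < n ] (δ i j * x j) ≈ x i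
  ∑-δ {suc n} zero x = begin
    1# * x zero + ∑[ j < n ] (0# * x (suc j))
      ≈⟨ +-cong (*-identityˡ _) (trans (sum-cong-≋ {n} (λ j → zeroˡ (x (suc j)))) (sum-replicate-zero n)) ⟩
    x zero + 0#                                ≈⟨ +-identityʳ _ ⟩
    x zero                                     ∎
  ∑-δ {suc n} (suc i) x = begin
    0# * x zero + ∑[ j < n ] (δ i j * x (suc j)) ≈⟨ +-cong (zeroˡ _) (∑-δ i (x ∘ suc)) ⟩
    0# + x (suc i)                               ≈⟨ +-identityˡ _ ⟩
    x (suc i)                                    ∎

module ℕΣ where
  open import Data.Nat using (_≤_)
  open import Algebra.Properties.Semiring.Sum ℕ.+-*-semiring public

  ∑-mono-≤ : ∀ {n} {x y : Vector ℕ n} → (∀ i → x i ≤ y i) → ∑[ i < n ] x i ≤ ∑[ i < n ] y i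
  ∑-mono-≤ {zero}  x≤y = z≤n
  ∑-mono-≤ {suc n} x≤y = ℕ.+-mono-≤ (x≤y zero) (∑-mono-≤ (x≤y ∘ suc))

  term≤∑ : ∀ {n} (x : Vector ℕ n) i → x i ≤ ∑[ j < n ] x j
  term≤∑ x zero    = ℕ.m≤m+n (x zero) _
  term≤∑ x (suc i) = ℕ.≤-trans (term≤∑ (x ∘ suc) i) (ℕ.m≤n+m _ (x zero))

  ∑-1 : ∀ n → ∑[ i < n ] 1 ≡ n
  ∑-1 zero    = refl
  ∑-1 (suc n) = cong suc (∑-1 n)

module BipartiteMatching where
  open import Data.Nat using (_*_; _≤_; _<_)
  open ℕΣ
  open KroneckerSum ℕ.+-*-semiring

  [_] : Bool → ℕ
  [ b ] = if b then 1 else 0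

  [T]≡1 : ∀ {b} → T b → [ b ] ≡ 1
  [T]≡1 {true} _ = refl

  count : ∀ {n} → (Fin n → Bool) → ℕ
  count {n} p = ∑[ i < n ] [ p i ]

  count-image : ∀ {m n} (g : Fin m → Fin n) (A : Fin m → Bool) (B : Fin n → Bool) →
                (∀ j → T (B j) → ∃ λ i → T (A i) × g i ≡ j) → count B ≤ count A
  count-image {m} {n} g A B B⊆gA = begin
    ∑[ j < n ] [ B j ]                        ≤⟨ ∑-mono-≤ covered ⟩
    ∑[ j < n ] ∑[ i < m ] (δ (g i) j * [ A i ]) ≡⟨ ∑-comm (λ i j → δ (g i) j * [ A i ]) ⟨
    ∑[ i < m ] ∑[ j < n ] (δ (g i) j * [ A i ]) ≡⟨ sum-cong-≗ (λ i → ∑-δ (g i) (const [ A i ])) ⟩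
    ∑[ i < m ] [ A i ]                        ∎
    where
    open ℕ.≤-Reasoning
    covered : ∀ j → [ B j ] ≤ ∑[ i < m ] (δ (g i) j * [ A i ])
    covered j with B j in Bj
    ... | false = z≤n
    ... | true with B⊆gA j (subst T (≡.sym Bj) tt)
    ...   | i , Ai , refl = ℕ.≤-trans (ℕ.≤-reflexive term-i≡1) (term≤∑ (λ i → δ (g i) j * [ A i ]) i)
      where
      term-i≡1 : 1 ≡ δ (g i) (g i) * [ A i ]
      term-i≡1 rewrite δ-refl (g i) | [T]≡1 Ai = refl

  insert : ∀ {n} → Fin n → (Fin n → Bool) → Fin n → Bool
  insert q S i = does (i ≟ q) ∨ S i

  insert-⊇ : ∀ {n} q (S : Fin n → Bool) i → T (S i) → T (insert q S i)
  insert-⊇ q S i Si with does (i ≟ q)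
  ... | true  = tt
  ... | false = Si

  count-insert : ∀ {n} (S : Fin n → Bool) q → ¬ T (S q) →
                 count (not ∘ insert q S) < count (not ∘ S)
  count-insert {suc n} S zero    ¬Sq with S zero
  ... | false = ℕ.n<1+n _
  ... | true  = contradiction tt ¬Sq
  count-insert {suc n} S (suc q) ¬Sq = ℕ.+-monoʳ-< _ (count-insert (S ∘ suc) q ¬Sq)

  module _ {m n} (R : Fin m → Fin n → Set) where

    Matching : Set
    Matching = Σ (Fin m → Fin n) λ f → Injective _≡_ _≡_ f × (∀ i → R i (f i))

    HallViolator : Set
    HallViolator = Σ (Fin m → Bool) λ A → Σ (Fin n → Bool) λ B →
      count B < count A × (∀ i j → T (A i) → R i j → T (B j))

  -- Augmenting paths without paths: row suc i is matched to g i and row zero is free. For each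
  -- reached row p we keep a matching of all rows but p, obtained from g by shifting along an
  -- alternating path from row zero. A reached row adjacent to a column outside g(S) either ends
  -- such a path at a free column or reaches a new row; if there is none, the reached rows violate
  -- Hall's condition.
  module Augment {m n} (R : Fin (suc m) → Fin (suc n) → Set) (R? : Decidable R)
    (g : Fin m → Fin (suc n)) (g-injective : Injective _≡_ _≡_ g) (g-valid : ∀ i → R (suc i) (g i)) where

    reached : (Fin m → Bool) → Fin (suc m) → Bool
    reached S zero    = true
    reached S (suc i) = S i


    record Exposing (S : Fin m → Bool) (p : Fin (suc m)) : Set where
      field
        h         : Fin (suc m) → Fin (suc n)
        valid     : ∀ x → x ≢ p → R x (h x)
        injective : ∀ {x y} → x ≢ p → y ≢ p → h x ≡ h y → x ≡ y
        image⊆g   : ∀ x → x ≢ p → ∃ λ i → g i ≡ h x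
        agrees    : ∀ i → ¬ T (S i) → h (suc i) ≡ g i

    Invariant : (Fin m → Bool) → Set
    Invariant S = ∀ p → T (reached S p) → Exposing S p

    Covered : (Fin m → Bool) → Fin (suc n) → Set
    Covered S j = ∃ λ i → T (S i) × g i ≡ j

    covered? : ∀ S j → Dec (Covered S j)
    covered? S j = any? (λ i → T? (S i) ×-dec (g i ≟ j))

    redirect : (Fin (suc m) → Fin (suc n)) → Fin (suc m) → Fin (suc n) → Fin (suc m) → Fin (suc n)
    redirect h p j x = if does (x ≟ p) then j else h x

    complete : ∀ {S p j} → Exposing S p → R p j → (∀ i → g i ≢ j) → Matching R
    complete {p = p} {j} e Rpj j∉g = redirect h p j , injective′ , valid′
      where
      open Exposing e
      j∉h : ∀ {x} → x ≢ p → h x ≢ j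
      j∉h x≢p hx≡j = let (i , gi≡hx) = image⊆g _ x≢p in j∉g i (≡.trans gi≡hx hx≡j)
      valid′ : ∀ x → R x (redirect h p j x)
      valid′ x with x ≟ p
      ... | yes refl = Rpj
      ... | no x≢p   = valid x x≢p
      injective′ : Injective _≡_ _≡_ (redirect h p j)
      injective′ {x} {y} eq with x ≟ p | y ≟ p
      ... | yes refl | yes refl = refl
      ... | yes refl | no y≢p   = contradiction (≡.sym eq) (j∉h y≢p)
      ... | no x≢p   | yes refl = contradiction eq (j∉h x≢p)
      ... | no x≢p   | no y≢p   = injective x≢p y≢p eq

    weaken : ∀ {S S′ p} → (∀ i → T (S i) → T (S′ i)) → Exposing S p → Exposing S′ p
    weaken S⊆S′ e = record
      { h = h ; valid = valid ; injective = injective ; image⊆g = image⊆g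
      ; agrees = λ i ¬S′i → agrees i (¬S′i ∘ S⊆S′ i) }
      where open Exposing e

    extend : ∀ {S p j q} → Exposing S p → T (reached S p) → R p j → g q ≡ j → ¬ T (S q) →
             Exposing (insert q S) (suc q)
    extend {S} {p} {j} {q} e reached-p Rpj gq≡j ¬Sq = record
      { h = redirect h p j ; valid = valid′ ; injective = injective′ ; image⊆g = image⊆g′ ; agrees = agrees′ }
      where
      open Exposing e
      unreached≢p : ∀ {i} → ¬ T (S i) → suc i ≢ p
      unreached≢p ¬Si refl = ¬Si reached-p
      h-sucq : h (suc q) ≡ j
      h-sucq = ≡.trans (agrees q ¬Sq) gq≡j
      valid′ : ∀ x → x ≢ suc q → R x (redirect h p j x)
      valid′ x _ with x ≟ p
      ... | yes refl = Rpj
      ... | no x≢p   = valid x x≢p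
      injective′ : ∀ {x y} → x ≢ suc q → y ≢ suc q → redirect h p j x ≡ redirect h p j y → x ≡ y
      injective′ {x} {y} x≢q y≢q eq with x ≟ p | y ≟ p
      ... | yes refl | yes refl = refl
      ... | yes refl | no y≢p   = contradiction (injective y≢p (unreached≢p ¬Sq) (≡.trans (≡.sym eq) (≡.sym h-sucq))) y≢q
      ... | no x≢p   | yes refl = contradiction (injective x≢p (unreached≢p ¬Sq) (≡.trans eq (≡.sym h-sucq))) x≢q
      ... | no x≢p   | no y≢p   = injective x≢p y≢p eq
      image⊆g′ : ∀ x → x ≢ suc q → ∃ λ i → g i ≡ redirect h p j x
      image⊆g′ x _ with x ≟ p
      ... | yes refl = q , gq≡j
      ... | no x≢p   = image⊆g x x≢p
      agrees′ : ∀ i → ¬ T (insert q S i) → redirect h p j (suc i) ≡ g i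
      agrees′ i ¬qSi with i ≟ q
      ... | yes refl = contradiction tt ¬qSi
      ... | no _ with suc i ≟ p
      ...   | yes refl = contradiction reached-p ¬qSi
      ...   | no _     = agrees i ¬qSi

    invariant-insert : ∀ {S p j q} → Invariant S → T (reached S p) → R p j → g q ≡ j → ¬ T (S q) →
                       Invariant (insert q S)
    invariant-insert {S} {q = q} inv _ _ _ _ zero _ = weaken (insert-⊇ q S) (inv zero tt)
    invariant-insert {S} {p} {q = q} inv reached-p Rpj gq≡j ¬Sq (suc i) qSi with i ≟ q
    ... | yes refl = extend (inv p reached-p) reached-p Rpj gq≡j ¬Sq
    ... | no _     = weaken (insert-⊇ q S) (inv (suc i) qSi)

    Augmentable : (Fin m → Bool) → Set
    Augmentable S = ∃₂ λ p j → T (reached S p) × R p j × ¬ Covered S j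

    augmentable? : ∀ S → Dec (Augmentable S)
    augmentable? S = any? λ p → any? λ j → T? (reached S p) ×-dec R? p j ×-dec ¬? (covered? S j)

    violator : ∀ S → ¬ Augmentable S → HallViolator R
    violator S stuck = reached S , B , s≤s (count-image g S B (λ j → toWitness)) , closed
      where
      B : Fin (suc n) → Bool
      B j = ⌊ covered? S j ⌋
      closed : ∀ i j → T (reached S i) → R i j → T (B j)
      closed i j reached-i Rij with covered? S j
      ... | yes _         = tt
      ... | no uncovered  = contradiction (i , j , reached-i , Rij , uncovered) stuck

    search : ∀ k S → count (not ∘ S) < k → Invariant S → Matching R ⊎ HallViolator R
    search (suc k) S bound inv with augmentable? S
    ... | no stuck = inj₂ (violator S stuck)
    ... | yes (p , j , reached-p , Rpj , uncovered) with any? (λ q → g q ≟ j)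
    ...   | no unmatched = inj₁ (complete (inv p reached-p) Rpj (λ q gq≡j → unmatched (q , gq≡j)))
    ...   | yes (q , gq≡j) =
      search k (insert q S) (ℕ.<-≤-trans (count-insert S q ¬Sq) (s≤s⁻¹ bound))
             (invariant-insert inv reached-p Rpj gq≡j ¬Sq)
      where
      ¬Sq : ¬ T (S q)
      ¬Sq Sq = uncovered (q , Sq , gq≡j)

    augment : Matching R ⊎ HallViolator R
    augment = search _ (const false) (ℕ.n<1+n _) invariant₀
      where
      h₀ : Fin (suc m) → Fin (suc n)
      h₀ zero    = zero
      h₀ (suc i) = g i
      valid₀ : ∀ x → x ≢ zero → R x (h₀ x)
      valid₀ zero    x≢0 = contradiction refl x≢0
      valid₀ (suc i) _   = g-valid i
      injective₀ : ∀ {x y} → x ≢ zero → y ≢ zero → h₀ x ≡ h₀ y → x ≡ y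
      injective₀ {zero}  x≢0 _   _  = contradiction refl x≢0
      injective₀ {suc _} {zero}  _ y≢0 _ = contradiction refl y≢0
      injective₀ {suc _} {suc _} _ _ eq = cong suc (g-injective eq)
      image⊆g₀ : ∀ x → x ≢ zero → ∃ λ i → g i ≡ h₀ x
      image⊆g₀ zero    x≢0 = contradiction refl x≢0
      image⊆g₀ (suc i) _   = i , refl
      invariant₀ : Invariant (const false)
      invariant₀ zero _ = record
        { h = h₀ ; valid = valid₀ ; injective = injective₀ ; image⊆g = image⊆g₀ ; agrees = λ _ _ → refl }

  hall : ∀ m n (R : Fin m → Fin n → Set) → Decidable R → Matching R ⊎ HallViolator R
  hall zero    n       R R? = inj₁ ((λ ()) , (λ { {()} }) , (λ ()))
  hall (suc m) zero    R R? = inj₂ (const true , (λ ()) , s≤s z≤n , λ _ ())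
  hall (suc m) (suc n) R R? with hall m (suc n) (R ∘ suc) (R? ∘ suc)
  ... | inj₁ (g , g-injective , g-valid) = Augment.augment R R? g g-injective g-valid
  ... | inj₂ (A , B , |B|<|A| , closed) = inj₂ (A′ , B , |B|<|A| , closed′)
    where
    A′ : Fin (suc m) → Bool
    A′ zero    = false
    A′ (suc i) = A i
    closed′ : ∀ i j → T (A′ i) → R i j → T (B j)
    closed′ (suc i) = closed i

module ℚΣ where
  open import Data.Rational using (_+_; _≤_)
  open import Algebra.Properties.Semiring.Sum (CommutativeRing.semiring ℚ.+-*-commutativeRing) public

  sumFin≡∑ : ∀ n (f : Fin n → ℚ) → sumFin n f ≡ ∑[ i < n ] f i
  sumFin≡∑ zero    f = refl
  sumFin≡∑ (suc n) f = cong (f zero +_) (sumFin≡∑ n (f ∘ suc))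

  ∑-mono-≤ : ∀ {n} {x y : Vector ℚ n} → (∀ i → x i ≤ y i) → ∑[ i < n ] x i ≤ ∑[ i < n ] y i
  ∑-mono-≤ {zero}  x≤y = ℚ.≤-refl
  ∑-mono-≤ {suc n} x≤y = ℚ.+-mono-≤ (x≤y zero) (∑-mono-≤ (x≤y ∘ suc))

module Transport where
  import Data.Integer as ℤ
  import Data.Integer.Properties as ℤ
  import Data.Nat.Coprimality as Coprime
  open import Data.Rational using (mkℚ; _+_; _*_; -_; _≤_; _<_; *≤*; nonNegative)
  open ℚΣ
  open KroneckerSum (CommutativeRing.semiring ℚ.+-*-commutativeRing)
  open BipartiteMatching using ([_]; count; HallViolator)

  -- IsCoupling, cost and W1Is of Defs with the distance matrix between N(x) and N(y) abstracted
  -- to D; instantiated at that matrix they are the same definitions.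
  IsUniformCoupling : ∀ m n → (Fin m → Fin n → ℚ) → Set
  IsUniformCoupling m n ν =
      (∀ i j → 0ℚ ≤ ν i j)
    × (∀ i → sumFin n (ν i) ≡ unif m)
    × (∀ j → sumFin m (λ i → ν i j) ≡ unif n)

  transportCost : ∀ {m n} → (Fin m → Fin n → ℕ) → (Fin m → Fin n → ℚ) → ℚ
  transportCost {m} {n} D ν = sumFin m λ i → sumFin n λ j → ν i j * nat (D i j)

  MinimalCostIs : ∀ {m n} → (Fin m → Fin n → ℕ) → ℚ → Set
  MinimalCostIs {m} {n} D w =
      (∀ ν → IsUniformCoupling m n ν → w ≤ transportCost D ν)
    × (∀ ε → 0ℚ < ε → ∃[ ν ] (IsUniformCoupling m n ν × transportCost D ν < w + ε))

  nat≡mkℚ : ∀ k → nat k ≡ mkℚ (ℤ.+ k) 0 (Coprime.sym (Coprime.1-coprimeTo k))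
  nat≡mkℚ k = ℚ.normalize-coprime (Coprime.sym (Coprime.1-coprimeTo k))

  unif≡mkℚ : ∀ k → unif (suc k) ≡ mkℚ (ℤ.+ 1) k (Coprime.1-coprimeTo (suc k))
  unif≡mkℚ k = ℚ.normalize-coprime (Coprime.1-coprimeTo (suc k))

  nat-+ : ∀ a b → nat (a ℕ.+ b) ≡ nat a + nat b
  nat-+ a b rewrite nat≡mkℚ a | nat≡mkℚ b | ℤ.*-identityʳ (ℤ.+ a) | ℤ.*-identityʳ (ℤ.+ b) = refl

  nat-mono-≤ : ∀ {a b} → a ℕ.≤ b → nat a ≤ nat b
  nat-mono-≤ {a} {b} a≤b rewrite nat≡mkℚ a | nat≡mkℚ b = *≤* (ℤ.*-monoʳ-≤-nonNeg (ℤ.+ 1) (ℤ.+≤+ a≤b))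

  nat-∑ : ∀ {n} (α : Fin n → ℕ) → nat (ℕΣ.sum α) ≡ ∑[ i < n ] nat (α i)
  nat-∑ {zero}  α = refl
  nat-∑ {suc n} α = ≡.trans (nat-+ (α zero) _) (cong (nat (α zero) +_) (nat-∑ (α ∘ suc)))

  unif*nat≡1 : ∀ k → unif (suc k) * nat (suc k) ≡ 1ℚ
  unif*nat≡1 k rewrite unif≡mkℚ k | nat≡mkℚ (suc k) =
    ℚ.*-inverseˡ (mkℚ (ℤ.+ suc k) 0 (Coprime.sym (Coprime.1-coprimeTo (suc k))))

  unif-pos : ∀ k → 0ℚ < unif (suc k)
  unif-pos k = ℚ.positive⁻¹ (unif (suc k)) {{ℚ.normalize-pos 1 (suc k)}}

  1<1+ε : ∀ {ε} → 0ℚ < ε → 1ℚ < 1ℚ + ε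
  1<1+ε {ε} ε>0 = subst (_< 1ℚ + ε) (ℚ.+-identityʳ 1ℚ) (ℚ.+-monoʳ-< 1ℚ ε>0)

  +-cancelʳ-≤ : ∀ {p q} r → p + r ≤ q + r → p ≤ q
  +-cancelʳ-≤ {p} {q} r p+r≤q+r = subst₂ _≤_ (+r-r p) (+r-r q) (ℚ.+-monoˡ-≤ (- r) p+r≤q+r)
    where
    +r-r : ∀ x → x + r + - r ≡ x
    +r-r x = ≡.trans (ℚ.+-assoc x r (- r)) (≡.trans (cong (x +_) (ℚ.+-inverseʳ r)) (ℚ.+-identityʳ x))

  kantorovich-weakDuality : ∀ {m n} (ν c : Fin m → Fin n → ℚ) {μ : Fin m → ℚ} {μ′ : Fin n → ℚ}
    (α : Fin m → ℚ) (β : Fin n → ℚ) → (∀ i j → 0ℚ ≤ ν i j) →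
    (∀ i → ∑[ j < n ] ν i j ≡ μ i) → (∀ j → ∑[ i < m ] ν i j ≡ μ′ j) → (∀ i j → α i ≤ c i j + β j) →
    ∑[ i < m ] (μ i * α i) ≤ ∑[ i < m ] ∑[ j < n ] (ν i j * c i j) + ∑[ j < n ] (μ′ j * β j)
  kantorovich-weakDuality {m} {n} ν c {μ} {μ′} α β ν≥0 rows cols α≤c+β = begin
    ∑[ i < m ] (μ i * α i)
      ≡⟨ sum-cong-≗ (λ i → ≡.trans (cong (_* α i) (≡.sym (rows i))) (*-distribʳ-sum (α i) (ν i))) ⟩
    ∑[ i < m ] ∑[ j < n ] (ν i j * α i)
      ≤⟨ ∑-mono-≤ (λ i → ∑-mono-≤ λ j → ℚ.*-monoˡ-≤-nonNeg (ν i j) {{nonNegative (ν≥0 i j)}} (α≤c+β i j)) ⟩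
    ∑[ i < m ] ∑[ j < n ] (ν i j * (c i j + β j))
      ≡⟨ sum-cong-≗ (λ i → ≡.trans (sum-cong-≗ λ j → ℚ.*-distribˡ-+ (ν i j) (c i j) (β j)) (∑-distrib-+ (νc i) (νβ i))) ⟩
    ∑[ i < m ] (∑[ j < n ] νc i j + ∑[ j < n ] νβ i j)
      ≡⟨ ∑-distrib-+ (λ i → ∑[ j < n ] νc i j) (λ i → ∑[ j < n ] νβ i j) ⟩
    C + ∑[ i < m ] ∑[ j < n ] νβ i j
      ≡⟨ cong (C +_) (∑-comm νβ) ⟩
    C + ∑[ j < n ] ∑[ i < m ] νβ i j
      ≡⟨ cong (C +_) (sum-cong-≗ λ j → ≡.trans (≡.sym (*-distribʳ-sum (β j) (λ i → ν i j))) (cong (_* β j) (cols j))) ⟩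
    C + ∑[ j < n ] (μ′ j * β j) ∎
    where
    open ℚ.≤-Reasoning
    νc νβ : Fin m → Fin n → ℚ
    νc i j = ν i j * c i j
    νβ i j = ν i j * β j
    C : ℚ
    C = ∑[ i < m ] ∑[ j < n ] νc i j

  *-nat-∑ : ∀ {n} q (α : Fin n → ℕ) → q * nat (ℕΣ.sum α) ≡ ∑[ i < n ] (q * nat (α i))
  *-nat-∑ {n} q α = ≡.trans (cong (q *_) (nat-∑ α)) (*-distribˡ-sum {n} q (nat ∘ α))

  transportCost≡∑∑ : ∀ {m n} (D : Fin m → Fin n → ℕ) ν →
                     transportCost D ν ≡ ∑[ i < m ] ∑[ j < n ] (ν i j * nat (D i j))
  transportCost≡∑∑ {m} {n} D ν =
    ≡.trans (sumFin≡∑ m _) (sum-cong-≗ λ i → sumFin≡∑ n (λ j → ν i j * nat (D i j)))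

  violator-potential : ∀ {d} a b → 1 ℕ.≤ d → (T a → d ≡ 1 → T b) → suc [ a ] ℕ.≤ d ℕ.+ [ b ]
  violator-potential {d}           false b     1≤d _      = ℕ.≤-trans 1≤d (ℕ.m≤m+n d [ b ])
  violator-potential               true  true  1≤d _      = ℕ.+-monoˡ-≤ 1 1≤d
  violator-potential {suc zero}    true  false _   closed = contradiction refl (closed tt)
  violator-potential {suc (suc d)} true  false _   _      = s≤s (s≤s z≤n)

  module _ {k : ℕ} (D : Fin (suc k) → Fin (suc k) → ℕ) where

    cost-lowerBound : ∀ {ν} → IsUniformCoupling (suc k) (suc k) ν →
      (α β : Fin (suc k) → ℕ) → (∀ i j → α i ℕ.≤ D i j ℕ.+ β j) →
      ∀ t → t ℕ.+ ℕΣ.sum β ℕ.≤ ℕΣ.sum α → unif (suc k) * nat t ≤ transportCost D ν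
    cost-lowerBound {ν} (ν≥0 , rows , cols) α β α≤D+β t t+∑β≤∑α = +-cancelʳ-≤ (u * nat (ℕΣ.sum β)) (begin
      u * nat t + u * nat (ℕΣ.sum β)
        ≡⟨ ≡.trans (≡.sym (ℚ.*-distribˡ-+ u _ _)) (cong (u *_) (≡.sym (nat-+ t _))) ⟩
      u * nat (t ℕ.+ ℕΣ.sum β)
        ≤⟨ ℚ.*-monoˡ-≤-nonNeg u {{nonNegative (ℚ.<⇒≤ (unif-pos k))}} (nat-mono-≤ t+∑β≤∑α) ⟩
      u * nat (ℕΣ.sum α)
        ≡⟨ *-nat-∑ u α ⟩
      ∑[ i < suc k ] (u * nat (α i))
        ≤⟨ kantorovich-weakDuality ν (λ i j → nat (D i j)) (nat ∘ α) (nat ∘ β) ν≥0 rows′ cols′ feasible ⟩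
      ∑[ i < suc k ] ∑[ j < suc k ] (ν i j * nat (D i j)) + ∑[ j < suc k ] (u * nat (β j))
        ≡⟨ cong₂ _+_ (≡.sym (transportCost≡∑∑ D ν)) (≡.sym (*-nat-∑ u β)) ⟩
      transportCost D ν + u * nat (ℕΣ.sum β) ∎)
      where
      open ℚ.≤-Reasoning
      u = unif (suc k)
      rows′ : ∀ i → ∑[ j < suc k ] ν i j ≡ u
      rows′ i = ≡.trans (≡.sym (sumFin≡∑ _ (ν i))) (rows i)
      cols′ : ∀ j → ∑[ i < suc k ] ν i j ≡ u
      cols′ j = ≡.trans (≡.sym (sumFin≡∑ _ (λ i → ν i j))) (cols j)
      feasible : ∀ i j → nat (α i) ≤ nat (D i j) + nat (β j)
      feasible i j = subst (nat (α i) ≤_) (nat-+ (D i j) (β j)) (nat-mono-≤ (α≤D+β i j))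

    cost≥1 : (∀ i j → 1 ℕ.≤ D i j) → ∀ {ν} → IsUniformCoupling (suc k) (suc k) ν → 1ℚ ≤ transportCost D ν
    cost≥1 D≥1 {ν} coupling = subst (_≤ transportCost D ν) (unif*nat≡1 k)
      (cost-lowerBound coupling (const 1) (const 0) (λ i j → ℕ.≤-trans (D≥1 i j) (ℕ.m≤m+n _ 0)) (suc k)
        (ℕ.≤-reflexive (≡.trans (cong (suc k ℕ.+_) (ℕΣ.sum-replicate-zero (suc k)))
                               (≡.trans (ℕ.+-identityʳ (suc k)) (≡.sym (ℕΣ.∑-1 (suc k)))))))

    cost≥1+unif : (∀ i j → 1 ℕ.≤ D i j) → HallViolator (λ i j → D i j ≡ 1) →
                  ∀ {ν} → IsUniformCoupling (suc k) (suc k) ν → 1ℚ + unif (suc k) ≤ transportCost D ν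
    cost≥1+unif D≥1 (a , b , |b|<|a| , closed) {ν} coupling = subst (_≤ transportCost D ν) u*nat[n+1]≡1+u
      (cost-lowerBound coupling α (λ j → [ b j ]) (λ i j → violator-potential (a i) (b j) (D≥1 i j) (closed i j))
        (suc k ℕ.+ 1) (begin
          suc k ℕ.+ 1 ℕ.+ count b   ≡⟨ ℕ.+-assoc (suc k) 1 (count b) ⟩
          suc k ℕ.+ suc (count b)   ≤⟨ ℕ.+-monoʳ-≤ (suc k) |b|<|a| ⟩
          suc k ℕ.+ count a         ≡⟨ cong (ℕ._+ count a) (ℕΣ.∑-1 (suc k)) ⟨
          ℕΣ.sum {suc k} (const 1) ℕ.+ count a ≡⟨ ℕΣ.∑-distrib-+ {suc k} (const 1) (λ i → [ a i ]) ⟨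
          ℕΣ.sum α                  ∎))
      where
      open ℕ.≤-Reasoning
      u = unif (suc k)
      α : Fin (suc k) → ℕ
      α i = suc [ a i ]
      u*nat[n+1]≡1+u : u * nat (suc k ℕ.+ 1) ≡ 1ℚ + u
      u*nat[n+1]≡1+u = ≡.trans (cong (u *_) (nat-+ (suc k) 1))
        (≡.trans (ℚ.*-distribˡ-+ u (nat (suc k)) (nat 1)) (cong₂ _+_ (unif*nat≡1 k) (ℚ.*-identityʳ u)))

    matchingCoupling : (σ : Fin (suc k) ⤖ Fin (suc k)) → (∀ i → D i (Bijection.to σ i) ≡ 1) →
                       ∃[ ν ] (IsUniformCoupling (suc k) (suc k) ν × transportCost D ν ≡ 1ℚ)
    matchingCoupling σ tight = ν , (ν≥0 , rows , cols) , cost≡1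
      where
      open Bijection σ using (to; injective; surjective)
      u = unif (suc k)
      ν : Fin (suc k) → Fin (suc k) → ℚ
      ν i j = δ (to i) j * u
      ν≥0 : ∀ i j → 0ℚ ≤ ν i j
      ν≥0 i j with does (to i ≟ j)
      ... | true  = ℚ.≤-trans (ℚ.<⇒≤ (unif-pos k)) (ℚ.≤-reflexive (≡.sym (ℚ.*-identityˡ u)))
      ... | false = ℚ.≤-reflexive (≡.sym (ℚ.*-zeroˡ u))
      rows : ∀ i → sumFin (suc k) (ν i) ≡ u
      rows i = ≡.trans (sumFin≡∑ _ (ν i)) (∑-δ (to i) (const u))
      cols : ∀ j → sumFin (suc k) (λ i → ν i j) ≡ u
      cols j with i₀ , to-i₀≡j ← surjective j with refl ← to-i₀≡j refl = begin
        sumFin (suc k) (λ i → δ (to i) (to i₀) * u) ≡⟨ sumFin≡∑ _ (λ i → δ (to i) (to i₀) * u) ⟩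
        ∑[ i < suc k ] (δ (to i) (to i₀) * u)     ≡⟨ sum-cong-≗ (λ i → cong (_* u) (≡.trans (δ-injective injective i i₀) (δ-sym i i₀))) ⟩
        ∑[ i < suc k ] (δ i₀ i * u)               ≡⟨ ∑-δ i₀ (const u) ⟩
        u                                         ∎
        where open ≡.≡-Reasoning
      cost≡1 : transportCost D ν ≡ 1ℚ
      cost≡1 = begin
        transportCost D ν                                           ≡⟨ transportCost≡∑∑ D ν ⟩
        ∑[ i < suc k ] ∑[ j < suc k ] (δ (to i) j * u * nat (D i j)) ≡⟨ sum-cong-≗ (λ i → sum-cong-≗ λ j → ℚ.*-assoc (δ (to i) j) u (nat (D i j))) ⟩
        ∑[ i < suc k ] ∑[ j < suc k ] (δ (to i) j * (u * nat (D i j))) ≡⟨ sum-cong-≗ (λ i → ∑-δ (to i) (λ j → u * nat (D i j))) ⟩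
        ∑[ i < suc k ] (u * nat (D i (to i)))                       ≡⟨ *-nat-∑ u (λ i → D i (to i)) ⟨
        u * nat (ℕΣ.sum (λ i → D i (to i)))                         ≡⟨ cong (λ s → u * nat s) (≡.trans (ℕΣ.sum-cong-≗ tight) (ℕΣ.∑-1 (suc k))) ⟩
        u * nat (suc k)                                             ≡⟨ unif*nat≡1 k ⟩
        1ℚ                                                          ∎
        where open ≡.≡-Reasoning

open BipartiteMatching using (hall)
open Transport

injective⇒surjective : ∀ {n} {f : Fin n → Fin n} → Injective _≡_ _≡_ f → ∀ j → ∃ λ i → f i ≡ j
injective⇒surjective {suc n} {f} f-injective j with any? (λ i → f i ≟ j)
... | yes hit  = hit
... | no miss = contradiction (injective⇒≤ punched-injective) ℕ.1+n≰n
  where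
  punched : Fin (suc n) → Fin n
  punched i = punchOut {i = j} (λ j≡fi → miss (i , ≡.sym j≡fi))
  punched-injective : Injective _≡_ _≡_ punched
  punched-injective eq = f-injective (punchOut-injective {i = j} _ _ eq)

minimalCost≡1⇔perfectMatching : ∀ {k m n} → m ≡ suc k → n ≡ suc k →
  (D : Fin m → Fin n → ℕ) → (∀ i j → 1 ℕ.≤ D i j) →
  MinimalCostIs D 1ℚ ⇔ Σ (Fin m ⤖ Fin n) (λ σ → ∀ i → D i (Bijection.to σ i) ≡ 1)
minimalCost≡1⇔perfectMatching {k} refl refl D D≥1 = mk⇔ matching optimal
  where
  matching : MinimalCostIs D 1ℚ → Σ (Fin (suc k) ⤖ Fin (suc k)) (λ σ → ∀ i → D i (Bijection.to σ i) ≡ 1)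
  matching (_ , nearlyOptimal) = [ perfect , ⊥-elim ∘ noViolator ]′ (hall _ _ (λ i j → D i j ≡ 1) (λ i j → D i j ℕ.≟ 1))
    where
    perfect : BipartiteMatching.Matching (λ i j → D i j ≡ 1) →
              Σ (Fin (suc k) ⤖ Fin (suc k)) (λ σ → ∀ i → D i (Bijection.to σ i) ≡ 1)
    perfect (f , f-injective , tight) = mk⤖ (f-injective , surjective) , tight
      where
      surjective : ∀ j → ∃ λ i → ∀ {i′} → i′ ≡ i → f i′ ≡ j
      surjective j = map₂ (λ { fi≡j refl → fi≡j }) (injective⇒surjective f-injective j)
    noViolator : ¬ BipartiteMatching.HallViolator (λ i j → D i j ≡ 1)
    noViolator violator = let ν , coupling , cost<1+u = nearlyOptimal (unif (suc k)) (unif-pos k) in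
      ℚ.<-irrefl refl (ℚ.<-≤-trans cost<1+u (cost≥1+unif D D≥1 violator coupling))
  optimal : Σ (Fin (suc k) ⤖ Fin (suc k)) (λ σ → ∀ i → D i (Bijection.to σ i) ≡ 1) → MinimalCostIs D 1ℚ
  optimal (σ , tight) = (λ _ → cost≥1 D D≥1) , nearlyOptimal
    where
    nearlyOptimal : ∀ ε → 0ℚ ℚ.< ε → ∃[ ν ] (IsUniformCoupling (suc k) (suc k) ν × transportCost D ν ℚ.< 1ℚ ℚ.+ ε)
    nearlyOptimal ε ε>0 = map₂ (map₂ λ cost≡1 → subst (ℚ._< 1ℚ ℚ.+ ε) (≡.sym cost≡1) (1<1+ε ε>0))
                                (matchingCoupling D σ tight)

module _ (G : Graph) (dist : Graph.V G → Graph.V G → ℕ) (metric : Graph.IsGraphMetric G dist) where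
  open Graph G
  open import Data.List.Membership.Propositional.Properties using (∈-lookup)
  import Data.List.Relation.Unary.Any as Any

  adjacent⇒≢ : ∀ {a b} → a ~ b → a ≢ b
  adjacent⇒≢ a~b refl = ~-irr a~b

  nb-adjacent : ∀ v i → v ~ nb v i
  nb-adjacent v i = Equivalence.to (nbrs-spec v (nb v i)) (∈-lookup i)

  adjacent⇒nb : ∀ {v w} → v ~ w → Fin (deg v)
  adjacent⇒nb {v} {w} v~w = Any.index (Equivalence.from (nbrs-spec v w) v~w)

  triangle : ∀ {x y z} → x ~ y → y ~ z → z ~ x → HasCycle 2
  triangle {x} {y} {z} x~y y~z z~x = vertex , injective , edge , z~x
    where
    vertex : Fin 3 → V
    vertex zero             = x
    vertex (suc zero)       = y
    vertex (suc (suc zero)) = z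
    edge : ∀ (i : Fin 2) → vertex (Data.Fin.inject₁ i) ~ vertex (suc i)
    edge zero       = x~y
    edge (suc zero) = y~z
    injective : Injective _≡_ _≡_ vertex
    injective {zero}           {zero}           _  = refl
    injective {suc zero}       {suc zero}       _  = refl
    injective {suc (suc zero)} {suc (suc zero)} _  = refl
    injective {zero}           {suc zero}       eq = contradiction eq (adjacent⇒≢ x~y)
    injective {zero}           {suc (suc zero)} eq = contradiction (≡.sym eq) (adjacent⇒≢ z~x)
    injective {suc zero}       {zero}           eq = contradiction (≡.sym eq) (adjacent⇒≢ x~y)
    injective {suc zero}       {suc (suc zero)} eq = contradiction eq (adjacent⇒≢ y~z)
    injective {suc (suc zero)} {zero}           eq = contradiction eq (adjacent⇒≢ z~x)
    injective {suc (suc zero)} {suc zero}       eq = contradiction (≡.sym eq) (adjacent⇒≢ y~z)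

  walk₀⇒≡ : ∀ {a b} → Walk a b 0 → a ≡ b
  walk₀⇒≡ here = refl

  walk₁⇒adjacent : ∀ {a b} → Walk a b 1 → a ~ b
  walk₁⇒adjacent (step a~b here) = a~b

  dist≡1⇒adjacent : ∀ {a b} → dist a b ≡ 1 → a ~ b
  dist≡1⇒adjacent {a} {b} eq = walk₁⇒adjacent (subst (Walk a b) eq (proj₁ (metric a b)))

  ≢⇒dist≥1 : ∀ {a b} → a ≢ b → 1 ℕ.≤ dist a b
  ≢⇒dist≥1 {a} {b} a≢b with dist a b in eq
  ... | zero  = contradiction (walk₀⇒≡ (subst (Walk a b) eq (proj₁ (metric a b)))) a≢b
  ... | suc _ = s≤s z≤n

  adjacent⇒dist≡1 : ∀ {a b} → a ~ b → dist a b ≡ 1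
  adjacent⇒dist≡1 {a} {b} a~b = ℕ.≤-antisym (proj₂ (metric a b) 1 (step a~b here)) (≢⇒dist≥1 (adjacent⇒≢ a~b))

  triangleFree⇒nb-dist≥1 : ¬ HasCycle 2 → ∀ {x y} → x ~ y → ∀ i j → 1 ℕ.≤ dist (nb x i) (nb y j)
  triangleFree⇒nb-dist≥1 no-triangle {x} {y} x~y i j = ≢⇒dist≥1 λ { eq →
    no-triangle (triangle x~y (≡.subst (y ~_) (≡.sym eq) (nb-adjacent y j)) (~-sym (nb-adjacent x i))) }

-- CurvatureIs G dist x y 0ℚ is MinimalCostIs D (1ℚ - 0ℚ),
-- and 1ℚ - 0ℚ computes to 1ℚ.
corollary4p3 : (G : Graph) → (dist : Graph.V G → Graph.V G → ℕ)
    → Graph.IsGraphMetric G dist → Graph.Connected G → Graph.Girth4 G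
    → (x y : Graph.V G) → Graph._~_ G x y
    → (d : ℕ) → Graph.deg G x ≡ d → Graph.deg G y ≡ d
    → CurvatureIs G dist x y 0ℚ ⇔ PerfectMatching G x y
corollary4p3 G dist metric _ _ x y x~y zero _ deg-y≡0 =
  ⊥-elim (¬Fin0 (subst Fin deg-y≡0 (adjacent⇒nb G dist metric (Graph.~-sym G x~y))))
corollary4p3 G dist metric _ (_ , no-triangle) x y x~y (suc k) deg-x≡d deg-y≡d =
  mk⇔ (map₂ (λ tight i → dist≡1⇒adjacent G dist metric (tight i)) ∘ to)
      (from ∘ map₂ (λ adjacent i → adjacent⇒dist≡1 G dist metric (adjacent i)))
  where
  open Equivalence (minimalCost≡1⇔perfectMatching deg-x≡d deg-y≡d (λ i j → dist (Graph.nb G x i) (Graph.nb G y j))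
                      (triangleFree⇒nb-dist≥1 G dist metric no-triangle x~y))
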